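{- If $G$ is a graph that has a Hamiltonian path and $G$ is not complete, then $tpc(G)=3$.
   Context: All graphs are simple, finite and undirected. A Hamiltonian path is a path containing every vertex of the graph. A graph is total-colored if every vertex and every edge receives a color. A path $v_1v_2\ldots v_s$ in a total-colored graph is a total proper path if (i) any two adjacent edges on the path have different colors, (ii) any two adjacent internal vertices of the path (vertices among $v_2,\ldots,v_{s-1}$) have different colors, and (iii) every internal vertex of the path has a color different from the colors of its two incident edges on the path. A total-colored graph is total proper connected if every two vertices are joined by a total proper path. For a connected graph $G$, the total proper connection number $tpc(G)$ is the smallest number of colors in a total-coloring making $G$ total proper connected. -}

module Defs where

open import Data.Nat using (ℕ; suc; _<_)
open import Data.Fin using (Fin)
open import Data.Bool using (Bool; true; false)
open import Data.List using (List; []; _∷_; _++_)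
open import Data.List.Membership.Propositional using (_∈_)
open import Data.List.Relation.Unary.Unique.Propositional using (Unique)
open import Data.Product using (Σ; ∃; _×_)
open import Data.Unit using (⊤)
open import Relation.Nullary using (¬_)
open import Relation.Binary.PropositionalEquality using (_≡_; _≢_)

record Graph (n : ℕ) : Set where
  field
    adj     : Fin n → Fin n → Bool
    adj-sym : ∀ u v → adj u v ≡ adj v u
    irrefl  : ∀ u → adj u u ≡ false
open Graph public

module _ {n : ℕ} (G : Graph n) where

  IsWalk : List (Fin n) → Set
  IsWalk [] = ⊤
  IsWalk (x ∷ []) = ⊤
  IsWalk (x ∷ y ∷ r) = (adj G x y ≡ true) × IsWalk (y ∷ r)

  IsPath : List (Fin n) → Set
  IsPath p = Unique p × IsWalk p

  HasHamiltonianPath : Set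
  HasHamiltonianPath = Σ (List (Fin n)) λ p → IsPath p × (∀ v → v ∈ p)

  IsComplete : Set
  IsComplete = ∀ u v → u ≢ v → adj G u v ≡ true

-- The edge color is given on ordered pairs and required symmetric, so it
-- is a color of the unordered edge {u,v}; values on non-edges are irrelevant.
record TotalColoring (n k : ℕ) : Set where
  field
    vcol     : Fin n → Fin k
    ecol     : Fin n → Fin n → Fin k
    ecol-sym : ∀ u v → ecol u v ≡ ecol v u
open TotalColoring public

module _ {n k : ℕ} (c : TotalColoring n k) where

  Cond-i-iii : List (Fin n) → Set
  Cond-i-iii (x ∷ y ∷ z ∷ r) =
    (ecol c x y ≢ ecol c y z) × (vcol c y ≢ ecol c x y) × (vcol c y ≢ ecol c y z)
    × Cond-i-iii (y ∷ z ∷ r)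
  Cond-i-iii _ = ⊤

  Cond-ii : List (Fin n) → Set
  Cond-ii (x ∷ y ∷ z ∷ w ∷ r) = (vcol c y ≢ vcol c z) × Cond-ii (y ∷ z ∷ w ∷ r)
  Cond-ii _ = ⊤

  IsTotalProper : List (Fin n) → Set
  IsTotalProper p = Cond-i-iii p × Cond-ii p

module _ {n k : ℕ} (G : Graph n) (c : TotalColoring n k) where

  TotalProperConnected : Set
  TotalProperConnected = ∀ u v → u ≢ v →
    Σ (List (Fin n)) λ mid →
      IsPath G (u ∷ (mid ++ (v ∷ []))) × IsTotalProper c (u ∷ (mid ++ (v ∷ [])))

TPConnectableWith : {n : ℕ} → Graph n → ℕ → Set
TPConnectableWith {n} G k = Σ (TotalColoring n k) λ c → TotalProperConnected G c

tpc≡ : {n : ℕ} → Graph n → ℕ → Set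
tpc≡ G k = TPConnectableWith G k × (∀ j → j < k → ¬ TPConnectableWith G j)

-- Number the vertices 0, 1, …, m along the Hamiltonian path, give the vertex at
-- position i the colour 2i mod 3 and an edge between positions i and j the
-- colour i + j mod 3.  On a stretch of the Hamiltonian path through positions
-- i, i+1, i+2 the two edges and the middle vertex get 2i+1, 2i+3 and 2i+2,
-- and consecutive vertices get colours differing by 2: all distinct mod 3.
-- So every stretch of the Hamiltonian path, read in either direction, is a
-- total proper path, and three colours suffice.  Conversely, a total proper
-- path between two non-adjacent vertices has an internal vertex, whose colour
-- and the colours of its two path edges are pairwise distinct.
module Submission where

open import Level using (Level)
open import Data.Nat using (ℕ; zero; suc; _+_; _<_; _≤_; s<s)
open import Data.Nat.Properties using (+-suc; +-comm; <-trans; <-irrefl; ≤-reflexive; ≮⇒≥; <⇒≱)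
open import Data.Fin using (Fin; zero; suc; _≟_)
open import Data.Fin.Properties using (pigeonhole; ¬∀⟶∃¬; all?)
open import Data.Bool using (true)
import Data.Bool as Bool
open import Data.List using (List; []; _∷_; _++_; [_]; reverse; _ʳ++_)
open import Data.List.Properties using (++-assoc; reverse-++; unfold-reverse)
open import Data.List.Membership.Propositional using (_∈_)
open import Data.List.Membership.Propositional.Properties using (∈-∃++; ∈-++⁻)
open import Data.List.Relation.Unary.Any using (here; there)
open import Data.List.Relation.Unary.All as All using (All; []; _∷_)
open import Data.List.Relation.Unary.AllPairs as AllPairs using (_∷_)
open import Data.List.Relation.Unary.Linked as Linked using (Linked; []; [-]; _∷_)
open import Data.List.Relation.Unary.Linked.Properties using (Linked⇒AllPairs)
open import Data.List.Relation.Unary.Unique.Propositional using (Unique)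
open import Data.Product using (∃; _×_; _,_; proj₁; proj₂)
open import Data.Sum using (_⊎_; inj₁; inj₂)
open import Data.Unit using (tt)
open import Data.Empty using (⊥-elim)
open import Function using (_∘_; flip; _on_)
open import Relation.Binary using (Rel; Transitive; Irreflexive; DecidableEquality)
open import Relation.Nullary using (¬_; Dec; yes; no)
open import Relation.Nullary.Decidable using (_→-dec_; ¬?)
open import Relation.Binary.PropositionalEquality
  using (_≡_; _≢_; refl; sym; trans; cong; subst; ≢-sym; module ≡-Reasoning)

open import Defs

private
  variable
    a ℓ : Level
    A : Set a

rotate : Fin 3 → Fin 3
rotate zero = suc zero
rotate (suc zero) = suc (suc zero)
rotate (suc (suc zero)) = zero

mod3 : ℕ → Fin 3
mod3 zero = zero
mod3 (suc k) = rotate (mod3 k)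

rotate-≢ : ∀ x → x ≢ rotate x
rotate-≢ zero ()
rotate-≢ (suc zero) ()
rotate-≢ (suc (suc zero)) ()

rotate²-≢ : ∀ x → x ≢ rotate (rotate x)
rotate²-≢ zero ()
rotate²-≢ (suc zero) ()
rotate²-≢ (suc (suc zero)) ()

mod3-≢-suc : ∀ k → mod3 k ≢ mod3 (suc k)
mod3-≢-suc k = rotate-≢ (mod3 k)

mod3-≢-2+ : ∀ k → mod3 k ≢ mod3 (2 + k)
mod3-≢-2+ k = rotate²-≢ (mod3 k)

mod3-consecutive-sums : ∀ {a b c} → b ≡ suc a → c ≡ suc b →
  (mod3 (a + b) ≢ mod3 (b + c)) × (mod3 (b + b) ≢ mod3 (a + b)) × (mod3 (b + b) ≢ mod3 (b + c))
mod3-consecutive-sums {a} refl refl rewrite +-suc a (suc a) =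
  mod3-≢-2+ (a + suc a) , ≢-sym (mod3-≢-suc (a + suc a)) , mod3-≢-suc (suc (a + suc a))

mod3-consecutive-doubles : ∀ {a b} → b ≡ suc a → mod3 (a + a) ≢ mod3 (b + b)
mod3-consecutive-doubles {a} refl rewrite +-suc a a = mod3-≢-2+ (a + a)

module _ {R : Rel A ℓ} where

  Linked-++⁻ˡ : ∀ xs {ys} → Linked R (xs ++ ys) → Linked R xs
  Linked-++⁻ˡ [] _ = []
  Linked-++⁻ˡ (x ∷ []) _ = [-]
  Linked-++⁻ˡ (x ∷ y ∷ xs) (r ∷ l) = r ∷ Linked-++⁻ˡ (y ∷ xs) l

  Linked-++⁻ʳ : ∀ xs {ys} → Linked R (xs ++ ys) → Linked R ys
  Linked-++⁻ʳ [] l = l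
  Linked-++⁻ʳ (x ∷ xs) l = Linked-++⁻ʳ xs (Linked.tail l)

  Linked-infix : ∀ pre ys {suf} → Linked R (pre ++ ys ++ suf) → Linked R ys
  Linked-infix pre ys = Linked-++⁻ˡ ys ∘ Linked-++⁻ʳ pre

  Linked-ʳ++⁺ : ∀ {x xs acc} → Linked R (x ∷ xs) → Linked (flip R) (x ∷ acc) →
                Linked (flip R) ((x ∷ xs) ʳ++ acc)
  Linked-ʳ++⁺ [-] l = l
  Linked-ʳ++⁺ (r ∷ rs) l = Linked-ʳ++⁺ rs (r ∷ l)

  Linked-reverse⁺ : ∀ {xs} → Linked R xs → Linked (flip R) (reverse xs)
  Linked-reverse⁺ [] = []
  Linked-reverse⁺ l@[-] = Linked-ʳ++⁺ l [-]
  Linked-reverse⁺ l@(_ ∷ _) = Linked-ʳ++⁺ l [-]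

  Linked-mapWithAll : ∀ {b ℓ′} {P : A → Set b} {S : Rel A ℓ′} {xs} →
                      (∀ {x y} → P x → P y → R x y → S x y) →
                      All P xs → Linked R xs → Linked S xs
  Linked-mapWithAll f [] [] = []
  Linked-mapWithAll f (_ ∷ []) [-] = [-]
  Linked-mapWithAll f (px ∷ ps@(py ∷ _)) (r ∷ l) = f px py r ∷ Linked-mapWithAll f ps l

  Linked⇒Unique : Transitive R → Irreflexive _≡_ R → ∀ {xs} → Linked R xs → Unique xs
  Linked⇒Unique trans irr = AllPairs.map (λ r eq → irr eq r) ∘ Linked⇒AllPairs trans

Stretch : List A → A → A → Set _
Stretch xs u v = ∃ λ pre → ∃ λ mid → ∃ λ suf → xs ≡ pre ++ (u ∷ mid ++ [ v ]) ++ suf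

stretch : ∀ {xs : List A} {u v} → u ∈ xs → v ∈ xs → u ≢ v → Stretch xs u v ⊎ Stretch xs v u
stretch {u = u} u∈xs v∈xs u≢v with ∈-∃++ u∈xs
... | ys , zs , refl with ∈-++⁻ ys v∈xs
...   | inj₂ (here v≡u) = ⊥-elim (u≢v (sym v≡u))
...   | inj₂ (there v∈zs) with ∈-∃++ v∈zs
...     | ms , ts , refl =
          inj₁ (ys , ms , ts , cong (λ l → ys ++ u ∷ l) (sym (++-assoc ms _ ts)))
stretch {u = u} u∈xs v∈xs u≢v | ys , zs , refl | inj₁ v∈ys with ∈-∃++ v∈ys
...   | ts , ms , refl =
        inj₂ (ts , ms , zs , trans (++-assoc ts _ (u ∷ zs))
                                   (cong (λ l → ts ++ _ ∷ l) (sym (++-assoc ms _ zs))))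

reverse-ends : ∀ (u v : A) mid → reverse (u ∷ mid ++ [ v ]) ≡ v ∷ reverse mid ++ [ u ]
reverse-ends u v mid = begin
  reverse ((u ∷ mid) ++ [ v ]) ≡⟨ reverse-++ (u ∷ mid) [ v ] ⟩
  v ∷ reverse (u ∷ mid)        ≡⟨ cong (v ∷_) (unfold-reverse u mid) ⟩
  v ∷ reverse mid ++ [ u ]     ∎
  where open ≡-Reasoning

module Position {A : Set a} (_≟ᴬ_ : DecidableEquality A) where

  position : List A → A → ℕ
  position [] v = 0
  position (x ∷ xs) v with x ≟ᴬ v
  ... | yes _ = 0
  ... | no _ = suc (position xs v)

  position-head : ∀ x xs → position (x ∷ xs) x ≡ 0
  position-head x xs with x ≟ᴬ x
  ... | yes _ = refl
  ... | no x≢x = ⊥-elim (x≢x refl)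

  position-there : ∀ {x v} xs → x ≢ v → position (x ∷ xs) v ≡ suc (position xs v)
  position-there {x} {v} xs x≢v with x ≟ᴬ v
  ... | yes x≡v = ⊥-elim (x≢v x≡v)
  ... | no _ = refl

  Successive : List A → Rel A _
  Successive xs x y = position xs y ≡ suc (position xs x)

  Unique⇒Linked-Successive : ∀ {xs} → Unique xs → Linked (Successive xs) xs
  Unique⇒Linked-Successive {[]} _ = []
  Unique⇒Linked-Successive {x ∷ []} _ = [-]
  Unique⇒Linked-Successive {x ∷ y ∷ xs} (x∉ ∷ u) =
    x↦y ∷ Linked-mapWithAll shift x∉ (Unique⇒Linked-Successive u)
    where
    x↦y : Successive (x ∷ y ∷ xs) x y
    x↦y = begin
      position (x ∷ y ∷ xs) y   ≡⟨ position-there (y ∷ xs) (All.head x∉) ⟩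
      suc (position (y ∷ xs) y) ≡⟨ cong suc (position-head y xs) ⟩
      1                         ≡⟨ cong suc (sym (position-head x (y ∷ xs))) ⟩
      suc (position (x ∷ y ∷ xs) x) ∎
      where open ≡-Reasoning
    shift : ∀ {v w} → x ≢ v → x ≢ w → Successive (y ∷ xs) v w → Successive (x ∷ y ∷ xs) v w
    shift {v} {w} x≢v x≢w v↦w = begin
      position (x ∷ y ∷ xs) w   ≡⟨ position-there (y ∷ xs) x≢w ⟩
      suc (position (y ∷ xs) w) ≡⟨ cong suc v↦w ⟩
      suc (suc (position (y ∷ xs) v)) ≡⟨ cong suc (sym (position-there (y ∷ xs) x≢v)) ⟩
      suc (position (x ∷ y ∷ xs) v) ∎
      where open ≡-Reasoning

module _ {n k : ℕ} (c : TotalColoring n k) where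

  TotalProperAt : Fin n → Fin n → Fin n → Set
  TotalProperAt x y z =
    (ecol c x y ≢ ecol c y z) × (vcol c y ≢ ecol c x y) × (vcol c y ≢ ecol c y z)

  TotalProperAt-reverse : ∀ {x y z} → TotalProperAt z y x → TotalProperAt x y z
  TotalProperAt-reverse {x} {y} {z} (zy≢yx , y≢zy , y≢yx) =
      (λ xy≡yz → zy≢yx (trans (ecol-sym c z y) (trans (sym xy≡yz) (ecol-sym c x y))))
    , (λ y≡xy → y≢yx (trans y≡xy (ecol-sym c x y)))
    , (λ y≡yz → y≢zy (trans y≡yz (ecol-sym c y z)))

  module _ {R : Rel (Fin n) ℓ}
           (proper : ∀ {x y z} → R x y → R y z → TotalProperAt x y z)
           (vcol-≢ : ∀ {x y} → R x y → vcol c x ≢ vcol c y) where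

    Linked⇒Cond-i-iii : ∀ {q} → Linked R q → Cond-i-iii c q
    Linked⇒Cond-i-iii [] = tt
    Linked⇒Cond-i-iii [-] = tt
    Linked⇒Cond-i-iii (_ ∷ [-]) = tt
    Linked⇒Cond-i-iii (r ∷ l@(r′ ∷ _)) =
      let (xy≢yz , y≢xy , y≢yz) = proper r r′ in xy≢yz , y≢xy , y≢yz , Linked⇒Cond-i-iii l

    Linked⇒Cond-ii : ∀ {q} → Linked R q → Cond-ii c q
    Linked⇒Cond-ii [] = tt
    Linked⇒Cond-ii [-] = tt
    Linked⇒Cond-ii (_ ∷ [-]) = tt
    Linked⇒Cond-ii (_ ∷ _ ∷ [-]) = tt
    Linked⇒Cond-ii (_ ∷ l@(r ∷ _ ∷ _)) = vcol-≢ r , Linked⇒Cond-ii l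

    Linked⇒IsTotalProper : ∀ {q} → Linked R q → IsTotalProper c q
    Linked⇒IsTotalProper l = Linked⇒Cond-i-iii l , Linked⇒Cond-ii l

module _ {n : ℕ} (G : Graph n) where

  Adjacent : Rel (Fin n) _
  Adjacent x y = adj G x y ≡ true

  IsWalk⇒Linked : ∀ {q} → IsWalk G q → Linked Adjacent q
  IsWalk⇒Linked {[]} _ = []
  IsWalk⇒Linked {x ∷ []} _ = [-]
  IsWalk⇒Linked {x ∷ y ∷ q} (xy , w) = xy ∷ IsWalk⇒Linked w

  Linked⇒IsWalk : ∀ {q} → Linked Adjacent q → IsWalk G q
  Linked⇒IsWalk [] = tt
  Linked⇒IsWalk [-] = tt
  Linked⇒IsWalk (xy ∷ l) = xy , Linked⇒IsWalk l

  Adjacent-sym : ∀ {x y} → Adjacent x y → Adjacent y x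
  Adjacent-sym {x} {y} = trans (adj-sym G y x)

module HamiltonianColouring {n : ℕ} (G : Graph n) (p : List (Fin n))
         (p-unique : Unique p) (p-walk : IsWalk G p) (p-covers : ∀ v → v ∈ p) where

  open Position (_≟_ {n})

  pos : Fin n → ℕ
  pos = position p

  colouring : TotalColoring n 3
  colouring = record
    { vcol     = λ x → mod3 (pos x + pos x)
    ; ecol     = λ x y → mod3 (pos x + pos y)
    ; ecol-sym = λ x y → cong mod3 (+-comm (pos x) (pos y))
    }

  Step : Rel (Fin n) _
  Step x y = Adjacent G x y × Successive p x y

  steps : Linked Step p
  steps = Linked.zip (IsWalk⇒Linked G p-walk , Unique⇒Linked-Successive p-unique)

  Successive⇒TotalProperAt : ∀ {x y z} → Successive p x y → Successive p y z →
                             TotalProperAt colouring x y z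
  Successive⇒TotalProperAt {x} {y} {z} = mod3-consecutive-sums {pos x} {pos y} {pos z}

  Successive⇒vcol-≢ : ∀ {x y} → Successive p x y → vcol colouring x ≢ vcol colouring y
  Successive⇒vcol-≢ {x} {y} = mod3-consecutive-doubles {pos x} {pos y}

  Successive⇒< : ∀ {x y} → Successive p x y → pos x < pos y
  Successive⇒< = ≤-reflexive ∘ sym

  TotalProperPath : List (Fin n) → Set
  TotalProperPath q = IsPath G q × IsTotalProper colouring q

  forward-path : ∀ {q} → Linked Step q → TotalProperPath q
  forward-path l =
      ( Linked⇒Unique {R = _<_ on pos} <-trans (<-irrefl ∘ cong pos)
          (Linked.map (Successive⇒< ∘ proj₂) l)
      , Linked⇒IsWalk G (Linked.map proj₁ l) )
    , Linked⇒IsTotalProper colouring {R = Successive p}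
        Successive⇒TotalProperAt Successive⇒vcol-≢ (Linked.map proj₂ l)

  backward-path : ∀ {q} → Linked (flip Step) q → TotalProperPath q
  backward-path l =
      ( Linked⇒Unique {R = flip (_<_ on pos)} (flip <-trans) (<-irrefl ∘ cong pos ∘ sym)
          (Linked.map (Successive⇒< ∘ proj₂) l)
      , Linked⇒IsWalk G (Linked.map (Adjacent-sym G ∘ proj₁) l) )
    , Linked⇒IsTotalProper colouring {R = flip (Successive p)} proper vcol-≢ (Linked.map proj₂ l)
    where
    proper : ∀ {x y z} → Successive p y x → Successive p z y → TotalProperAt colouring x y z
    proper {x} {y} {z} y↦x z↦y =
      TotalProperAt-reverse colouring {x} {y} {z} (Successive⇒TotalProperAt z↦y y↦x)
    vcol-≢ : ∀ {x y} → Successive p y x → vcol colouring x ≢ vcol colouring y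
    vcol-≢ {x} {y} = ≢-sym ∘ Successive⇒vcol-≢ {y} {x}

  total-proper-connected : TotalProperConnected G colouring
  total-proper-connected u v u≢v with stretch (p-covers u) (p-covers v) u≢v
  ... | inj₁ (pre , mid , _ , p≡) =
        mid , forward-path (Linked-infix pre (u ∷ mid ++ [ v ]) (subst (Linked Step) p≡ steps))
  ... | inj₂ (pre , mid , _ , p≡) =
        reverse mid , subst TotalProperPath (reverse-ends v u mid)
          (backward-path (Linked-reverse⁺
            (Linked-infix pre (v ∷ mid ++ [ u ]) (subst (Linked Step) p≡ steps))))

pairwise-distinct⇒3≤ : ∀ {j} {x y z : Fin j} → x ≢ y → x ≢ z → y ≢ z → 3 ≤ j
pairwise-distinct⇒3≤ {j} {x} {y} {z} x≢y x≢z y≢z = ≮⇒≥ j≮3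
  where
  triple : Fin 3 → Fin j
  triple zero = x
  triple (suc zero) = y
  triple (suc (suc zero)) = z
  j≮3 : ¬ j < 3
  j≮3 j<3 with pigeonhole j<3 triple
  ... | zero , suc zero , _ , x≡y = x≢y x≡y
  ... | zero , suc (suc zero) , _ , x≡z = x≢z x≡z
  ... | suc zero , suc (suc zero) , _ , y≡z = y≢z y≡z
  ... | suc zero , suc zero , s<s () , _
  ... | suc (suc zero) , suc (suc zero) , s<s (s<s ()) , _

TotalProperAt⇒3≤ : ∀ {n k} (c : TotalColoring n k) {x y z} → TotalProperAt c x y z → 3 ≤ k
TotalProperAt⇒3≤ c (xy≢yz , y≢xy , y≢yz) = pairwise-distinct⇒3≤ y≢xy y≢yz xy≢yz

distinct⇒adjacent? : ∀ {n} (G : Graph n) u v → Dec (u ≢ v → Adjacent G u v)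
distinct⇒adjacent? G u v = ¬? (u ≟ v) →-dec (adj G u v Bool.≟ true)

non-complete⇒nonadjacent : ∀ {n} (G : Graph n) → ¬ IsComplete G →
                           ∃ λ u → ∃ λ v → u ≢ v × ¬ Adjacent G u v
non-complete⇒nonadjacent {n} G incomplete
  with ¬∀⟶∃¬ n _ (all? ∘ distinct⇒adjacent? G) incomplete
... | u , ¬∀v with ¬∀⟶∃¬ n _ (distinct⇒adjacent? G u) ¬∀v
... | v , ¬[u≢v→u~v] =
  u , v , (λ u≡v → ¬[u≢v→u~v] (λ u≢v → ⊥-elim (u≢v u≡v))) , (λ u~v → ¬[u≢v→u~v] (λ _ → u~v))

non-complete⇒3≤ : ∀ {n k} (G : Graph n) → ¬ IsComplete G → TPConnectableWith G k → 3 ≤ k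
non-complete⇒3≤ G incomplete (c , connected) with non-complete⇒nonadjacent G incomplete
... | u , v , u≢v , u≁v with connected u v u≢v
... | [] , (_ , u~v , _) , _ = ⊥-elim (u≁v u~v)
... | _ ∷ [] , _ , (uy≢yv , y≢uy , y≢yv , _) , _ = TotalProperAt⇒3≤ c (uy≢yv , y≢uy , y≢yv)
... | _ ∷ _ ∷ _ , _ , (uy≢yz , y≢uy , y≢yz , _) , _ = TotalProperAt⇒3≤ c (uy≢yz , y≢uy , y≢yz)

corollary2 : (n : ℕ) (G : Graph n) → HasHamiltonianPath G → ¬ IsComplete G → tpc≡ G 3
corollary2 n G (p , (p-unique , p-walk) , p-covers) incomplete =
    (colouring , total-proper-connected)
  , λ j j<3 connectable → <⇒≱ j<3 (non-complete⇒3≤ G incomplete connectable)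
  where open HamiltonianColouring G p p-unique p-walk p-covers
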